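{- Let $\Gamma$ be a connected trivalent graph. Suppose $G\le\mathrm{Aut}(\Gamma)$ acts vertex- and edge-transitively on $\Gamma$ and the stabilizers in $G$ of vertices of $\Gamma$ are infinite. Then $\Gamma$ is the $3$-regular tree.
   Context: Graphs are simple; trivalent means every vertex has degree 3. -}

module Defs where

open import Data.Nat using (ℕ; _≤_)
open import Data.List using (List; []; _∷_; _++_; [_]; length)
open import Data.List.Relation.Unary.Any using (Any)
open import Data.List.Relation.Unary.Unique.Propositional using (Unique)
open import Data.List.Relation.Unary.Linked using (Linked)
open import Data.Product using (Σ; ∃; _×_; _,_)
open import Data.Sum using (_⊎_)
open import Relation.Nullary using (¬_)
open import Relation.Binary.PropositionalEquality using (_≡_)

record Graph : Set₁ where
  field
    V     : Set
    E     : V → V → Set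
    sym   : ∀ {u v} → E u v → E v u
    irrefl : ∀ {v} → ¬ E v v

module _ (Γ : Graph) where
  open Graph Γ

  Trivalent : Set
  Trivalent = ∀ v → Σ V λ a → Σ V λ b → Σ V λ c →
    E v a × E v b × E v c ×
    ¬ a ≡ b × ¬ a ≡ c × ¬ b ≡ c ×
    (∀ w → E v w → w ≡ a ⊎ w ≡ b ⊎ w ≡ c)

  data Walk : V → V → Set where
    here : ∀ {v} → Walk v v
    step : ∀ {u w v} → E u w → Walk w v → Walk u v

  Connected : Set
  Connected = ∀ u v → Walk u v

  record Cycle : Set where
    field
      x      : V
      ys     : List V
      long   : 2 ≤ length ys
      unique : Unique (x ∷ ys)
      closed : Linked E (x ∷ ys ++ [ x ])

  Acyclic : Set
  Acyclic = ¬ Cycle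

  IsTree : Set
  IsTree = Connected × Acyclic

  record Aut : Set where
    field
      to       : V → V
      from     : V → V
      to-from  : ∀ v → to (from v) ≡ v
      from-to  : ∀ v → from (to v) ≡ v
      pres     : ∀ {u v} → E u v → E (to u) (to v)
      refl'    : ∀ {u v} → E (to u) (to v) → E u v

  open Aut public

  idAut : Aut
  idAut = record { to = λ v → v ; from = λ v → v
                 ; to-from = λ v → Relation.Binary.PropositionalEquality.refl
                 ; from-to = λ v → Relation.Binary.PropositionalEquality.refl
                 ; pres = λ e → e ; refl' = λ e → e }

  _∘A_ : Aut → Aut → Aut
  g ∘A h = record
    { to = λ v → to g (to h v)
    ; from = λ v → from h (from g v)
    ; to-from = λ v → Relation.Binary.PropositionalEquality.trans
        (Relation.Binary.PropositionalEquality.cong (to g) (to-from h (from g v))) (to-from g v)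
    ; from-to = λ v → Relation.Binary.PropositionalEquality.trans
        (Relation.Binary.PropositionalEquality.cong (from h) (from-to g (to h v))) (from-to h v)
    ; pres = λ e → pres g (pres h e)
    ; refl' = λ e → refl' h (refl' g e) }

  invAut : Aut → Aut
  invAut g = record
    { to = from g ; from = to g ; to-from = from-to g ; from-to = to-from g
    ; pres = λ {u} {v} e → refl' g (Relation.Binary.PropositionalEquality.subst₂ E
               (Relation.Binary.PropositionalEquality.sym (to-from g u))
               (Relation.Binary.PropositionalEquality.sym (to-from g v)) e)
    ; refl' = λ {u} {v} e → Relation.Binary.PropositionalEquality.subst₂ E
               (to-from g u) (to-from g v) (pres g e) }

  _≈A_ : Aut → Aut → Set
  g ≈A h = ∀ v → to g v ≡ to h v

  record IsSubgroup (G : Aut → Set) : Set where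
    field
      has-id  : G idAut
      has-∘   : ∀ {g h} → G g → G h → G (g ∘A h)
      has-inv : ∀ {g} → G g → G (invAut g)

  VertexTransitive : (Aut → Set) → Set
  VertexTransitive G = ∀ u v → Σ Aut λ g → G g × to g u ≡ v

  EdgeTransitive : (Aut → Set) → Set
  EdgeTransitive G = ∀ u v x y → E u v → E x y →
    Σ Aut λ g → G g × ((to g u ≡ x × to g v ≡ y) ⊎ (to g u ≡ y × to g v ≡ x))

  FiniteStabilizer : (Aut → Set) → V → Set
  FiniteStabilizer G v = Σ (List Aut) λ L →
    ∀ g → G g → to g v ≡ v → Any (λ h → g ≈A h) L

  InfiniteStabilizer : (Aut → Set) → V → Set
  InfiniteStabilizer G v = ¬ FiniteStabilizer G v

{-# OPTIONS --safe #-}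
module Submission where

-- If G is not arc-transitive, edge-transitivity orients every edge G-invariantly, as an image either of
-- a fixed arc (u, v) or of (v, u).  The vertex u has an out-neighbour v and an in-neighbour, so it has a
-- unique out-neighbour or a unique in-neighbour; by vertex-transitivity so does every vertex.  This gives a
-- G-equivariant parent map without periodic points (a sibling of a periodic point is its image under G),
-- whereas following the parent map along a cycle produces one.
--
-- If G is arc-transitive we follow Tutte.  If the pointwise stabiliser of every s-arc fixed the neighbours
-- of the initial vertex, an arc stabiliser would fix the whole connected graph, so an element of G_v would
-- be determined by the image of one (s+1)-arc at v, of which there are finitely many.  Hence for each s
-- some s-arc stabiliser swaps the two further neighbours of its initial vertex, and by induction G is
-- transitive on s-arcs for every s.  But a cycle x, y₁, …, yₖ gives the s-arc x, y₁, …, yₖ, x, y₁ and one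
-- that differs from it only in its initial vertex.
--
-- The goal Acyclic is negative, so excluded middle is available throughout, through the ¬¬ monad.

open import Defs
open import Level using (0ℓ)
open import Data.Nat using (ℕ; zero; suc; _≤_; s≤s)
open import Data.Nat.Properties using (m≤n⇒m⊓n≡m; ≤-reflexive; m≤n⇒m≤1+n; suc-injective; +-comm)
open import Data.Fin using (Fin; zero; suc; _≟_)
open import Data.Fin.Properties using (all?; any?)
open import Data.Vec using (lookup; _∷_; [])
open import Data.Vec.Relation.Unary.All using ([]; _∷_)
open import Data.Vec.Relation.Unary.AllPairs using ([]; _∷_)
open import Data.Vec.Relation.Unary.Unique.Propositional.Properties using (lookup-injective)
open import Data.List using (List; []; _∷_; _++_; _∷ʳ_; _ʳ++_; length; map; reverse; take; concatMap; allFin)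
open import Data.List.Properties
  using (∷-injectiveˡ; ∷-injectiveʳ; map-id; map-∘; map-id-local; length-map; length-take; length-++; length-reverse;
         take++drop≡id; reverse-++; unfold-reverse; reverse-involutive)
open import Data.List.Relation.Unary.All as All using (All; []; _∷_)
open import Data.List.Relation.Unary.All.Properties using (take⁺) renaming (map⁺ to All-map⁺)
open import Data.List.Relation.Unary.AllPairs using (AllPairs; []; _∷_)
open import Data.List.Relation.Unary.Any as Any using (Any; here; there)
open import Data.List.Relation.Unary.Linked as Linked using (Linked; []; [-]; _∷_)
open import Data.List.Relation.Unary.Linked.Properties using () renaming (map⁺ to Linked-map⁺)
open import Data.List.Membership.Propositional using (_∈_)
open import Data.List.Membership.Propositional.Properties using (∈-map⁺; ∈-concat⁺′; ∈-allFin; ∈-++⁺ʳ)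
open import Data.Product using (∃; _×_; _,_; proj₁; proj₂)
open import Data.Sum as Sum using (_⊎_; inj₁; inj₂)
open import Data.Unit using (⊤; tt)
open import Data.Empty using (⊥)
open import Effect.Monad using (RawMonad)
open import Function using (_∘_; flip)
open import Relation.Binary.Definitions using (Symmetric)
open import Relation.Nullary using (¬_; Dec; yes; no)
open import Relation.Nullary.Decidable using (toWitness; ¬?; _→-dec_; _×-dec_; map′; ¬¬-excluded-middle)
open import Relation.Nullary.Negation using (¬¬-Monad; contradiction)
open import Relation.Binary.PropositionalEquality
  using (_≡_; _≢_; refl; sym; trans; cong; cong₂; subst; subst₂; ≢-sym; module ≡-Reasoning)

open RawMonad (¬¬-Monad {a = 0ℓ})

fin3-remaining : (i j k l : Fin 3) → i ≢ j → i ≢ k → j ≢ k → l ≢ i → l ≢ j → l ≡ k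
fin3-remaining = toWitness {a? = all? λ i → all? λ j → all? λ k → all? λ l →
  ¬? (i ≟ j) →-dec ¬? (i ≟ k) →-dec ¬? (j ≟ k) →-dec ¬? (l ≟ i) →-dec ¬? (l ≟ j) →-dec (l ≟ k)} _

fin3-avoid₂ : (i j : Fin 3) → i ≢ j → ∃ λ k → k ≢ i × k ≢ j
fin3-avoid₂ = toWitness {a? = all? λ i → all? λ j → ¬? (i ≟ j) →-dec any? λ k → ¬? (k ≟ i) ×-dec ¬? (k ≟ j)} _

fin3-avoid₁ : (i : Fin 3) → ∃ λ k → k ≢ i
fin3-avoid₁ = toWitness {a? = all? λ i → any? λ k → ¬? (k ≟ i)} _

module _ {A B : Set} (Q : A → B → Set) where

  Covers : List B → List A → Set
  Covers bs as = ∀ {b} → b ∈ bs → ∃ (λ a → Q a b) → Any (λ a → Q a b) as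

  finite-choice : ∀ bs → ¬ ¬ ∃ (Covers bs)
  finite-choice []       = pure ([] , λ ())
  finite-choice (b ∷ bs) = do
    (as , covers) ← finite-choice bs
    b-hit? ← ¬¬-excluded-middle
    pure (extend b-hit? as covers)
    where
    extend : Dec (∃ λ a → Q a b) → ∀ as → Covers bs as → ∃ (Covers (b ∷ bs))
    extend (yes (a , q)) as covers = a ∷ as , λ { (here refl) _ → here q ; (there m) hit → there (covers m hit) }
    extend (no miss)     as covers = as , λ { (here refl) hit → contradiction hit miss ; (there m) hit → covers m hit }

module _ {A : Set} {R : A → A → Set} where

  Linked-ʳ++ : Symmetric R → ∀ {a} xs ys → Linked R (a ∷ xs) → Linked R (a ∷ ys) → Linked R (xs ʳ++ a ∷ ys)
  Linked-ʳ++ R-sym []       ys _         q = q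
  Linked-ʳ++ R-sym (b ∷ xs) ys (Rab ∷ p) q = Linked-ʳ++ R-sym xs _ p (R-sym Rab ∷ q)

  Linked-reverse : Symmetric R → ∀ {xs} → Linked R xs → Linked R (reverse xs)
  Linked-reverse R-sym {[]}     [] = []
  Linked-reverse R-sym {a ∷ xs} p  = Linked-ʳ++ R-sym xs [] p [-]

  Linked-++⁻ˡ : ∀ xs {ys} → Linked R (xs ++ ys) → Linked R xs
  Linked-++⁻ˡ []           _       = []
  Linked-++⁻ˡ (x ∷ [])     _       = [-]
  Linked-++⁻ˡ (x ∷ y ∷ xs) (r ∷ p) = r ∷ Linked-++⁻ˡ (y ∷ xs) p

  Linked-∷ʳ : ∀ xs {z w} → Linked R (xs ∷ʳ z) → R z w → Linked R (xs ++ z ∷ w ∷ [])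
  Linked-∷ʳ []           _        r = r ∷ [-]
  Linked-∷ʳ (x ∷ [])     (r′ ∷ _) r = r′ ∷ r ∷ [-]
  Linked-∷ʳ (x ∷ y ∷ xs) (r′ ∷ p) r = r′ ∷ Linked-∷ʳ (y ∷ xs) p r

module _ {A : Set} where

  All-ʳ++ : ∀ {P : A → Set} {xs ys} → All P xs → All P ys → All P (xs ʳ++ ys)
  All-ʳ++ []       q = q
  All-ʳ++ (p ∷ ps) q = All-ʳ++ ps (p ∷ q)

  All-reverse : ∀ {P : A → Set} {xs} → All P xs → All P (reverse xs)
  All-reverse p = All-ʳ++ p []

  map-cong-local⁻ : ∀ {B : Set} {f g : A → B} xs → map f xs ≡ map g xs → All (λ x → f x ≡ g x) xs
  map-cong-local⁻ []       _  = []
  map-cong-local⁻ (x ∷ xs) eq = ∷-injectiveˡ eq ∷ map-cong-local⁻ xs (∷-injectiveʳ eq)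

  length-∷ʳ : ∀ (xs : List A) x → length (xs ∷ʳ x) ≡ suc (length xs)
  length-∷ʳ xs x = trans (length-++ xs) (+-comm (length xs) 1)

module Trivalence (Γ : Graph) (tri : Trivalent Γ) where
  open Graph Γ renaming (sym to E-sym)

  record Neighbourhood (v : V) : Set where
    field
      neighbour  : Fin 3 → V
      adjacent   : ∀ i → E v (neighbour i)
      injective  : ∀ {i j} → neighbour i ≡ neighbour j → i ≡ j
      surjective : ∀ {w} → E v w → ∃ λ i → w ≡ neighbour i

  neighbourhood : ∀ v → Neighbourhood v
  neighbourhood v with tri v
  ... | a , b , c , ea , eb , ec , a≢b , a≢c , b≢c , cover = record
    { neighbour  = lookup (a ∷ b ∷ c ∷ [])
    ; adjacent   = λ { zero → ea ; (suc zero) → eb ; (suc (suc zero)) → ec }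
    ; injective  = lookup-injective ((a≢b ∷ a≢c ∷ []) ∷ (b≢c ∷ []) ∷ [] ∷ []) _ _
    ; surjective = λ {w} e → index (cover w e)
    }
    where
    index : ∀ {w} → w ≡ a ⊎ w ≡ b ⊎ w ≡ c → ∃ λ i → w ≡ lookup (a ∷ b ∷ c ∷ []) i
    index (inj₁ w≡a)        = zero , w≡a
    index (inj₂ (inj₁ w≡b)) = suc zero , w≡b
    index (inj₂ (inj₂ w≡c)) = suc (suc zero) , w≡c

  neighbour : V → Fin 3 → V
  neighbour v = Neighbourhood.neighbour (neighbourhood v)

  some-neighbour : ∀ v → ∃ (E v)
  some-neighbour v = neighbour v zero , Neighbourhood.adjacent (neighbourhood v) zero

  walks : V → ℕ → List (List V)
  walks v zero    = (v ∷ []) ∷ []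
  walks v (suc n) = map (v ∷_) (concatMap (λ i → walks (neighbour v i) n) (allFin 3))

  walks-complete : ∀ {v} l → Linked E (v ∷ l) → (v ∷ l) ∈ walks v (length l)
  walks-complete         []      _       = here refl
  walks-complete {v} (w ∷ l) (e ∷ p) with Neighbourhood.surjective (neighbourhood v) e
  ... | i , refl = ∈-map⁺ (v ∷_)
    (∈-concat⁺′ (walks-complete l p) (∈-map⁺ (λ j → walks (neighbour v j) (length l)) (∈-allFin i)))

  module _ {v : V} where
    open Neighbourhood (neighbourhood v) using (adjacent; injective; surjective)

    private
      index : ∀ {w} → E v w → Fin 3
      index e = proj₁ (surjective e)

      index-correct : ∀ {w} (e : E v w) → w ≡ neighbour v (index e)
      index-correct e = proj₂ (surjective e)

      same-index : ∀ {a b} (ea : E v a) (eb : E v b) → index ea ≡ index eb → a ≡ b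
      same-index ea eb i≡j = trans (index-correct ea) (trans (cong (neighbour v) i≡j) (sym (index-correct eb)))

      index-cong : ∀ {a b} (ea : E v a) (eb : E v b) → a ≡ b → index ea ≡ index eb
      index-cong ea eb a≡b = injective (trans (sym (index-correct ea)) (trans a≡b (index-correct eb)))

      index-≢ : ∀ {a b} (ea : E v a) (eb : E v b) → a ≢ b → index ea ≢ index eb
      index-≢ ea eb a≢b = a≢b ∘ same-index ea eb

      neighbour-≢ : ∀ {a} k (ea : E v a) → k ≢ index ea → neighbour v k ≢ a
      neighbour-≢ k ea k≢i nk≡a = k≢i (injective (trans nk≡a (index-correct ea)))

    adjacent-≟ : ∀ {a b} → E v a → E v b → Dec (a ≡ b)
    adjacent-≟ ea eb = map′ (same-index ea eb) (index-cong ea eb) (index ea ≟ index eb)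

    fourth-neighbour : ∀ {a b c d} → E v a → E v b → E v c → E v d →
      a ≢ b → a ≢ c → b ≢ c → d ≢ a → d ≢ b → d ≡ c
    fourth-neighbour ea eb ec ed a≢b a≢c b≢c d≢a d≢b = same-index ed ec (fin3-remaining _ _ _ _
      (index-≢ ea eb a≢b) (index-≢ ea ec a≢c) (index-≢ eb ec b≢c) (index-≢ ed ea d≢a) (index-≢ ed eb d≢b))

    another-neighbour : ∀ {a} → E v a → ∃ λ c → E v c × c ≢ a
    another-neighbour ea with fin3-avoid₁ (index ea)
    ... | k , k≢i = neighbour v k , adjacent k , neighbour-≢ k ea k≢i

    third-neighbour : ∀ {a b} → E v a → E v b → a ≢ b → ∃ λ c → E v c × c ≢ a × c ≢ b
    third-neighbour ea eb a≢b with fin3-avoid₂ (index ea) (index eb) (index-≢ ea eb a≢b)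
    ... | k , k≢i , k≢j = neighbour v k , adjacent k , neighbour-≢ k ea k≢i , neighbour-≢ k eb k≢j

module Arcs (Γ : Graph) where
  open Graph Γ renaming (sym to E-sym)

  NonBacktracking : List V → Set
  NonBacktracking (a ∷ b ∷ c ∷ l) = a ≢ c × NonBacktracking (b ∷ c ∷ l)
  NonBacktracking _               = ⊤

  IsArc : List V → Set
  IsArc l = Linked E l × NonBacktracking l

  Arc : ℕ → List V → Set
  Arc s l = IsArc l × length l ≡ suc s

  -- the closed walk a, b, …, a, b: repeating the first edge makes the turn at a part of the condition
  ClosedArc : V → V → List V → Set
  ClosedArc a b mid = IsArc (a ∷ b ∷ mid ++ a ∷ b ∷ [])

  arc-tail : ∀ {a l} → IsArc (a ∷ l) → IsArc l
  arc-tail {l = []}        _         = [] , tt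
  arc-tail {l = _ ∷ []}    (p , _)   = Linked.tail p , tt
  arc-tail {l = _ ∷ _ ∷ _} (p , _ , q) = Linked.tail p , q

  private
    NonBacktracking-ʳ++ : ∀ {a c} xs ys → NonBacktracking (c ∷ a ∷ xs) → NonBacktracking (a ∷ c ∷ ys) →
      NonBacktracking (xs ʳ++ a ∷ c ∷ ys)
    NonBacktracking-ʳ++ []       ys _         q = q
    NonBacktracking-ʳ++ (b ∷ xs) ys (c≢b , p) q = NonBacktracking-ʳ++ xs _ p (≢-sym c≢b , q)

    NonBacktracking-++⁻ˡ : ∀ xs {ys} → NonBacktracking (xs ++ ys) → NonBacktracking xs
    NonBacktracking-++⁻ˡ []               _       = tt
    NonBacktracking-++⁻ˡ (_ ∷ [])         _       = tt
    NonBacktracking-++⁻ˡ (_ ∷ _ ∷ [])     _       = tt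
    NonBacktracking-++⁻ˡ (x ∷ y ∷ z ∷ xs) (p , q) = p , NonBacktracking-++⁻ˡ (y ∷ z ∷ xs) q

  arc-reverse : ∀ {l} → IsArc l → IsArc (reverse l)
  arc-reverse {[]}         _       = [] , tt
  arc-reverse {_ ∷ []}     _       = [-] , tt
  arc-reverse {c ∷ a ∷ xs} (p , q) = Linked-reverse E-sym p , NonBacktracking-ʳ++ xs [] q tt

  arc-++⁻ˡ : ∀ xs {ys} → IsArc (xs ++ ys) → IsArc xs
  arc-++⁻ˡ xs (p , q) = Linked-++⁻ˡ xs p , NonBacktracking-++⁻ˡ xs q

  arc-take : ∀ n {l} → IsArc l → IsArc (take n l)
  arc-take n {l} arc = arc-++⁻ˡ (take n l) (subst IsArc (sym (take++drop≡id n l)) arc)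

  closedArc-reverse : ∀ {a b} mid → ClosedArc a b mid → ClosedArc b a (reverse mid)
  closedArc-reverse {a} {b} mid arc = subst IsArc reversed (arc-reverse arc)
    where
    open ≡-Reasoning
    reversed : reverse (a ∷ b ∷ mid ++ a ∷ b ∷ []) ≡ b ∷ a ∷ reverse mid ++ b ∷ a ∷ []
    reversed = begin
      reverse ((a ∷ b ∷ mid) ++ a ∷ b ∷ [])   ≡⟨ reverse-++ (a ∷ b ∷ mid) (a ∷ b ∷ []) ⟩
      b ∷ a ∷ reverse ((a ∷ b ∷ []) ++ mid)   ≡⟨ cong (λ l → b ∷ a ∷ l) (reverse-++ (a ∷ b ∷ []) mid) ⟩
      b ∷ a ∷ reverse mid ++ b ∷ a ∷ []       ∎

  private
    NonBacktracking-wrap : ∀ {a b} p s₀ s → AllPairs _≢_ (p ∷ s₀ ∷ s) →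
      All (a ≢_) (p ∷ s₀ ∷ s) → All (b ≢_) (s₀ ∷ s) → NonBacktracking (p ∷ s₀ ∷ s ++ a ∷ b ∷ [])
    NonBacktracking-wrap p s₀ []       _                      (a≢p ∷ _) (b≢s₀ ∷ _) =
      ≢-sym a≢p , ≢-sym b≢s₀ , tt
    NonBacktracking-wrap p s₀ (s₁ ∷ s) ((_ ∷ p≢s₁ ∷ _) ∷ ps) (_ ∷ as)  (_ ∷ bs)    =
      p≢s₁ , NonBacktracking-wrap s₀ s₁ s ps as bs

  cycle-closedArc : Cycle Γ → ∃ λ a → ∃ λ b → ∃ λ c → ∃ λ m → ClosedArc a b (c ∷ m)
  cycle-closedArc record { ys = [] ; long = () }
  cycle-closedArc record { ys = _ ∷ [] ; long = s≤s () }
  cycle-closedArc record { x = x ; ys = y₁ ∷ y₂ ∷ r ; closed = closed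
                         ; unique = x≢ys@(_ ∷ x≢y₂ ∷ _) ∷ ys-distinct@(y₁≢ys ∷ _) } =
    x , y₁ , y₂ , r , Linked-∷ʳ (x ∷ y₁ ∷ y₂ ∷ r) closed (Linked.head closed) ,
    x≢y₂ , NonBacktracking-wrap y₁ y₂ r ys-distinct x≢ys y₁≢ys

module Automorphisms (Γ : Graph) where
  open Graph Γ hiding (sym)

  infixr 9 _·_
  _·_ : Aut Γ → Aut Γ → Aut Γ
  _·_ = _∘A_ Γ

  infix 10 _⁻¹
  _⁻¹ : Aut Γ → Aut Γ
  _⁻¹ = invAut Γ

  to-injective : ∀ (g : Aut Γ) {a b} → to g a ≡ to g b → a ≡ b
  to-injective g {a} {b} ga≡gb = trans (sym (from-to g a)) (trans (cong (from g) ga≡gb) (from-to g b))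

  Linked-map : ∀ (g : Aut Γ) {l} → Linked E l → Linked E (map (to g) l)
  Linked-map g p = Linked-map⁺ (Linked.map (pres g) p)

  Fixes : Aut Γ → List V → Set
  Fixes k = All (λ a → to k a ≡ a)

  map-fixes : ∀ (g : Aut Γ) {l} → map (to g) l ≡ l → Fixes g l
  map-fixes g {l} eq = map-cong-local⁻ l (trans eq (sym (map-id l)))

  agree⇒fixes : ∀ {g h l} → All (λ a → to h a ≡ to g a) l → Fixes (h ⁻¹ · g) l
  agree⇒fixes {g} {h} = All.map λ {a} ha≡ga → trans (cong (from h) (sym ha≡ga)) (from-to h a)

  conjugate-fixes : ∀ (g : Aut Γ) {k l} → Fixes k l → Fixes (g · k · g ⁻¹) (map (to g) l)
  conjugate-fixes g {k} fix = All-map⁺ (All.map (λ {a} ka≡a → cong (to g) (trans (cong (to k) (from-to g a)) ka≡a)) fix)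

module Orientation (Γ : Graph) (tri : Trivalent Γ) (G : Aut Γ → Set) (sg : IsSubgroup Γ G)
  (vt : VertexTransitive Γ G) (R : Graph.V Γ → Graph.V Γ → Set)
  (R-invariant : ∀ {g a b} → G g → R a b → R (to g a) (to g b))
  (R-total : ∀ {a b} → Graph.E Γ a b → R a b ⊎ R b a)
  (R-asym : ∀ {a b} → R a b → ¬ R b a) where
  open Graph Γ renaming (sym to E-sym)
  open Trivalence Γ tri
  open Arcs Γ
  open Automorphisms Γ
  open IsSubgroup sg

  IsUniqueOut : V → V → Set
  IsUniqueOut x y = E x y × R x y × (∀ {w} → E x w → R x w → w ≡ y)

  uniqueOut-intro : ∀ {u a b c} → E u a → E u b → E u c → a ≢ b → a ≢ c → b ≢ c →
    R a u → R b u → R u c → IsUniqueOut u c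
  uniqueOut-intro ea eb ec a≢b a≢c b≢c Rau Rbu Ruc = ec , Ruc , λ ew Ruw →
    fourth-neighbour ea eb ec ew a≢b a≢c b≢c (λ { refl → R-asym Ruw Rau }) (λ { refl → R-asym Ruw Rbu })

  uniqueOut-invariant : ∀ {g x y} → G g → IsUniqueOut x y → IsUniqueOut (to g x) (to g y)
  uniqueOut-invariant {g} {x} Gg (e , r , unique) = pres g e , R-invariant Gg r , λ {w} e′ r′ →
    trans (sym (to-from g w)) (cong (to g) (unique
      (subst (λ z → E z (from g w)) (from-to g x) (pres (g ⁻¹) e′))
      (subst (λ z → R z (from g w)) (from-to g x) (R-invariant (has-inv Gg) r′))))

  module Parent {u₀ p₀} (out₀ : IsUniqueOut u₀ p₀) where

    uniqueOut : ∀ y → ∃ (IsUniqueOut y)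
    uniqueOut y with vt u₀ y
    ... | g , Gg , gu₀≡y = to g p₀ , subst (λ z → IsUniqueOut z (to g p₀)) gu₀≡y (uniqueOut-invariant Gg out₀)

    parent : V → V
    parent y = proj₁ (uniqueOut y)

    parent-adjacent : ∀ y → E y (parent y)
    parent-adjacent y = proj₁ (proj₂ (uniqueOut y))

    parent-R : ∀ y → R y (parent y)
    parent-R y = proj₁ (proj₂ (proj₂ (uniqueOut y)))

    parent-unique : ∀ {y w} → E y w → R y w → w ≡ parent y
    parent-unique {y} = proj₂ (proj₂ (proj₂ (uniqueOut y)))

    parent-equivariant : ∀ {h} → G h → ∀ x → parent (to h x) ≡ to h (parent x)
    parent-equivariant {h} Gh x = sym (parent-unique (pres h (parent-adjacent x))
      (R-invariant Gh (parent-R x)))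

    parent-edge : ∀ {a b} → E a b → parent b ≡ a ⊎ parent a ≡ b
    parent-edge e with R-total e
    ... | inj₁ Rab = inj₂ (sym (parent-unique e Rab))
    ... | inj₂ Rba = inj₁ (sym (parent-unique (E-sym e) Rba))

    child : ∀ {y w} → E y w → w ≢ parent y → parent w ≡ y
    child e w≢py with parent-edge e
    ... | inj₁ pw≡y = pw≡y
    ... | inj₂ py≡w = contradiction (sym py≡w) w≢py

    grandparent-≢ : ∀ c → c ≢ parent (parent c)
    grandparent-≢ c c≡ppc = R-asym (parent-R c) (subst (R (parent c)) (sym c≡ppc) (parent-R (parent c)))

    ancestor : ℕ → V → V
    ancestor zero    x = x
    ancestor (suc n) x = parent (ancestor n x)

    ancestor-equivariant : ∀ {h} → G h → ∀ n x → ancestor n (to h x) ≡ to h (ancestor n x)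
    ancestor-equivariant Gh zero    x = refl
    ancestor-equivariant Gh (suc n) x = trans (cong parent (ancestor-equivariant Gh n x)) (parent-equivariant Gh (ancestor n x))

    siblings-ancestor : ∀ {x y} → parent x ≡ parent y → ∀ n → ancestor (suc n) x ≡ ancestor (suc n) y
    siblings-ancestor px≡py zero    = px≡py
    siblings-ancestor px≡py (suc n) = cong parent (siblings-ancestor px≡py n)

    -- A sibling z of c is the image of c under G, hence periodic with the same ancestors as c.
    no-periodic-point : ∀ {c} n → ancestor (suc n) c ≢ c
    no-periodic-point {c} n periodic
      with third-neighbour (E-sym (parent-adjacent c)) (parent-adjacent (parent c)) (grandparent-≢ c)
    ... | z , e , z≢c , z≢ppc with vt c z
    ... | h , Gh , hc≡z = z≢c (begin
      z                          ≡⟨ sym hc≡z ⟩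
      to h c                     ≡⟨ cong (to h) (sym periodic) ⟩
      to h (ancestor (suc n) c)  ≡⟨ sym (ancestor-equivariant Gh (suc n) c) ⟩
      ancestor (suc n) (to h c)  ≡⟨ cong (ancestor (suc n)) hc≡z ⟩
      ancestor (suc n) z         ≡⟨ siblings-ancestor (child e z≢ppc) n ⟩
      ancestor (suc n) c         ≡⟨ periodic ⟩
      c                          ∎)
      where open ≡-Reasoning

    ParentOf : V → V → Set
    ParentOf u v = parent v ≡ u

    ancestor-chain : ∀ {a} xs {z ys} → Linked ParentOf (a ∷ xs ++ z ∷ ys) → ancestor (suc (length xs)) z ≡ a
    ancestor-chain []       (pz≡a ∷ _) = pz≡a
    ancestor-chain (x ∷ xs) (px≡a ∷ p) = trans (cong parent (ancestor-chain xs p)) px≡a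

    backward-arc : ∀ {a b l} → IsArc (a ∷ b ∷ l) → parent b ≡ a → Linked ParentOf (a ∷ b ∷ l)
    backward-arc {l = []}    _                   pb≡a = pb≡a ∷ [-]
    backward-arc {l = c ∷ l} (_ ∷ p , a≢c , q) pb≡a =
      pb≡a ∷ backward-arc (p , q) (child (Linked.head p) λ c≡pb → a≢c (trans (sym pb≡a) (sym c≡pb)))

    closedArc-not-backward : ∀ {a b} mid → ClosedArc a b mid → parent b ≢ a
    closedArc-not-backward {b = b} mid arc pb≡a =
      no-periodic-point (suc (length mid)) (ancestor-chain (b ∷ mid) (backward-arc arc pb≡a))

    no-closedArc : ∀ {a b} mid → ClosedArc a b mid → ⊥
    no-closedArc mid arc with parent-edge (Linked.head (proj₁ arc))
    ... | inj₁ pb≡a = closedArc-not-backward mid arc pb≡a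
    ... | inj₂ pa≡b = closedArc-not-backward (reverse mid) (closedArc-reverse mid arc) pa≡b

module HalfArcTransitive (Γ : Graph) (tri : Trivalent Γ) (G : Aut Γ → Set) (sg : IsSubgroup Γ G)
  (vt : VertexTransitive Γ G) (et : EdgeTransitive Γ G) where
  open Graph Γ renaming (sym to E-sym)
  open Trivalence Γ tri
  open Automorphisms Γ
  open IsSubgroup sg

  module _ {u v x y} (euv : E u v) (exy : E x y)
    (no-map : ¬ ∃ λ g → G g × to g u ≡ x × to g v ≡ y) where

    _⇀_ : V → V → Set
    a ⇀ b = ∃ λ g → G g × to g u ≡ a × to g v ≡ b

    ⇀-invariant : ∀ {h a b} → G h → a ⇀ b → to h a ⇀ to h b
    ⇀-invariant {h} Gh (g , Gg , ga , gb) = h · g , has-∘ Gh Gg , cong (to h) ga , cong (to h) gb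

    ⇀-total : ∀ {a b} → E a b → a ⇀ b ⊎ b ⇀ a
    ⇀-total e with et u v _ _ euv e
    ... | g , Gg , inj₁ (gu , gv) = inj₁ (g , Gg , gu , gv)
    ... | g , Gg , inj₂ (gu , gv) = inj₂ (g , Gg , gu , gv)

    -- Both orientations give g₂⁻¹ g₁ swapping u and v, and with it a map of (u, v) onto (x, y).
    ⇀-asym : ∀ {a b} → a ⇀ b → ¬ b ⇀ a
    ⇀-asym (g₁ , G₁ , g₁u , g₁v) (g₂ , G₂ , g₂u , g₂v) with ⇀-total exy
    ... | inj₁ x⇀y = no-map x⇀y
    ... | inj₂ (g , Gg , gu , gv) = no-map (g · g₂ ⁻¹ · g₁ , has-∘ Gg (has-∘ (has-inv G₂) G₁) ,
      trans (cong (to g) (swap g₁u g₂v)) gv , trans (cong (to g) (swap g₁v g₂u)) gu)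
      where
      swap : ∀ {c d e} → to g₁ c ≡ e → to g₂ d ≡ e → from g₂ (to g₁ c) ≡ d
      swap {d = d} g₁c g₂d = trans (cong (from g₂) (trans g₁c (sym g₂d))) (from-to g₂ d)

    u⇀v : u ⇀ v
    u⇀v = idAut Γ , has-id , refl , refl

    in-neighbour : ∃ λ w → E u w × w ⇀ u × w ≢ v
    in-neighbour with vt v u
    ... | g , Gg , gv≡u =
      to g u , E-sym (subst (E (to g u)) gv≡u (pres g euv)) , gu⇀u , λ { refl → ⇀-asym u⇀v gu⇀u }
      where
      gu⇀u : to g u ⇀ u
      gu⇀u = subst (to g u ⇀_) gv≡u (⇀-invariant Gg u⇀v)

    module Forward  = Orientation Γ tri G sg vt _⇀_ ⇀-invariant ⇀-total ⇀-asym
    module Backward = Orientation Γ tri G sg vt (flip _⇀_) ⇀-invariant (Sum.swap ∘ ⇀-total) (flip ⇀-asym)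

    no-closedArc : ∀ {a b} mid → Arcs.ClosedArc Γ a b mid → ⊥
    no-closedArc mid arc with in-neighbour
    ... | w , euw , w⇀u , w≢v with third-neighbour euv euw (≢-sym w≢v)
    ... | z , euz , z≢v , z≢w with ⇀-total euz
    ... | inj₁ u⇀z = Backward.Parent.no-closedArc
      (Backward.uniqueOut-intro euv euz euw (≢-sym z≢v) (≢-sym w≢v) z≢w u⇀v u⇀z w⇀u) mid arc
    ... | inj₂ z⇀u = Forward.Parent.no-closedArc
      (Forward.uniqueOut-intro euw euz euv (≢-sym z≢w) w≢v z≢v w⇀u z⇀u u⇀v) mid arc

module Tutte (Γ : Graph) (tri : Trivalent Γ) (conn : Connected Γ) (G : Aut Γ → Set) (sg : IsSubgroup Γ G)
  (infinite : ∀ v → InfiniteStabilizer Γ G v) where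
  open Graph Γ renaming (sym to E-sym)
  open Trivalence Γ tri
  open Arcs Γ
  open Automorphisms Γ
  open IsSubgroup sg

  Rigid : ℕ → Set
  Rigid s = ∀ {y l k w} → Arc s (y ∷ l) → G k → Fixes k (y ∷ l) → E y w → to k w ≡ w

  arc-prepend : ∀ {y l} → IsArc (y ∷ l) → ∃ λ z → IsArc (z ∷ y ∷ l)
  arc-prepend {y} {[]} _ with some-neighbour y
  ... | z , e = z , (E-sym e ∷ [-]) , tt
  arc-prepend {l = q ∷ r} (p , nb) with another-neighbour (Linked.head p)
  ... | z , e , z≢q = z , (E-sym e ∷ p) , z≢q , nb

  arc-exists : V → ∀ s → ∃ λ y → ∃ λ l → Arc s (y ∷ l)
  arc-exists v₀ zero = v₀ , [] , ([-] , tt) , refl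
  arc-exists v₀ (suc s) with arc-exists v₀ s
  ... | y , l , arc , len with arc-prepend arc
  ... | z , arc′ = z , y ∷ l , arc′ , cong suc len

  module _ {s k} (rigid : Rigid s) (k∈G : G k) where

    rigid-long : ∀ {y l w} → IsArc (y ∷ l) → s ≤ length l → Fixes k (y ∷ l) → E y w → to k w ≡ w
    rigid-long {l = l} arc s≤l fix =
      rigid (arc-take (suc s) arc , cong suc (trans (length-take s l) (m≤n⇒m⊓n≡m s≤l))) k∈G (take⁺ (suc s) fix)

    extend-start : ∀ {l} → IsArc l → suc s ≤ length l → Fixes k l → ∃ λ z → IsArc (z ∷ l) × Fixes k (z ∷ l)
    extend-start {y ∷ l} arc (s≤s s≤l) fix with arc-prepend arc
    ... | z , arc′ = z , arc′ , rigid-long arc s≤l fix (E-sym (Linked.head (proj₁ arc′))) ∷ fix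

    extend-end : ∀ {l} → IsArc l → suc s ≤ length l → Fixes k l → ∃ λ z → IsArc (l ∷ʳ z) × Fixes k (l ∷ʳ z)
    extend-end {l} arc len fix
      with extend-start (arc-reverse arc) (subst (suc s ≤_) (sym (length-reverse l)) len) (All-reverse fix)
    ... | z , arc′ , fix′ = z , subst IsArc reversed (arc-reverse arc′) , subst (Fixes k) reversed (All-reverse fix′)
      where
      reversed : reverse (z ∷ reverse l) ≡ l ∷ʳ z
      reversed = trans (unfold-reverse z (reverse l)) (cong (_∷ʳ z) (reverse-involutive l))

    -- An arc fixed by k can be slid along any walk, one step at a time, keeping it fixed.
    rigid-fixes-reachable : ∀ {u v} → Walk Γ u v →
      ∀ {l} → IsArc (u ∷ l) → suc s ≤ length l → Fixes k (u ∷ l) → to k v ≡ v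
    rigid-fixes-reachable here arc len fix = All.head fix
    rigid-fixes-reachable (step e walk) {q ∷ r} arc (s≤s s≤r) fix with adjacent-≟ e (Linked.head (proj₁ arc))
    ... | no w≢q = rigid-fixes-reachable walk (E-sym e ∷ proj₁ arc , w≢q , proj₂ arc) (s≤s (m≤n⇒m≤1+n s≤r))
      (rigid-long arc (m≤n⇒m≤1+n s≤r) fix e ∷ fix)
    ... | yes refl with extend-end arc (s≤s (m≤n⇒m≤1+n s≤r)) fix
    ... | z , arc′ , fix′ =
      rigid-fixes-reachable walk (arc-tail arc′) (subst (suc s ≤_) (sym (length-∷ʳ r z)) (s≤s s≤r)) (All.tail fix′)

  -- G_y maps y ∷ l to one of finitely many walks, and elements with the same image differ by an element
  -- fixing y ∷ l.
  trivial-arc-stabiliser⇒finite : ∀ {y l} → Linked E (y ∷ l) →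
    (∀ {k} → G k → Fixes k (y ∷ l) → ∀ v → to k v ≡ v) → ¬ ¬ FiniteStabilizer Γ G y
  trivial-arc-stabiliser⇒finite {y} {l} walk trivial = do
    (hs , chosen) ← finite-choice (λ h β → G h × map (to h) (y ∷ l) ≡ β) (walks y (length l))
    pure (hs , λ g g∈G gy≡y → Any.map (agree g g∈G) (chosen (image-is-walk g gy≡y) (g , g∈G , refl)))
    where
    image-is-walk : ∀ g → to g y ≡ y → map (to g) (y ∷ l) ∈ walks y (length l)
    image-is-walk g gy≡y = subst₂ (λ z n → (z ∷ map (to g) l) ∈ walks y n) (sym gy≡y) (length-map (to g) l)
      (walks-complete (map (to g) l) (subst (λ z → Linked E (z ∷ map (to g) l)) gy≡y (Linked-map g walk)))
    agree : ∀ g → G g → ∀ {h} → G h × map (to h) (y ∷ l) ≡ map (to g) (y ∷ l) → _≈A_ Γ g h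
    agree g g∈G {h} (h∈G , same-image) v = trans (sym (to-from h (to g v)))
      (cong (to h) (trivial (has-∘ (has-inv h∈G) g∈G) (agree⇒fixes {g} {h} (map-cong-local⁻ (y ∷ l) same-image)) v))

  rigid⇒finite-stabiliser : ∀ {s y l} → Rigid s → Arc (suc s) (y ∷ l) → ¬ ¬ FiniteStabilizer Γ G y
  rigid⇒finite-stabiliser {y = y} rigid (arc , len) = trivial-arc-stabiliser⇒finite (proj₁ arc) λ k∈G fix v →
    rigid-fixes-reachable rigid k∈G (conn y v) arc (≤-reflexive (sym (suc-injective len))) fix

  not-rigid : V → ∀ s → ¬ Rigid s
  not-rigid v₀ s rigid with arc-exists v₀ (suc s)
  ... | y , l , arc = rigid⇒finite-stabiliser rigid arc (infinite y)

  Unsettles : Aut Γ → V → V → Set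
  Unsettles k y q = ∀ {w} → E y w → w ≢ q → to k w ≢ w

  moved-neighbour : ∀ {k y q a b} → to k y ≡ y → to k q ≡ q → E y q → E y a → E y b →
    q ≢ a → q ≢ b → a ≢ b → to k a ≢ a → to k a ≡ b
  moved-neighbour {k} ky≡y kq≡q eq ea eb q≢a q≢b a≢b ka≢a =
    fourth-neighbour eq ea eb (subst (λ z → E z (to k _)) ky≡y (pres k ea)) q≢a q≢b a≢b
      (λ ka≡q → q≢a (sym (to-injective k (trans ka≡q (sym kq≡q))))) ka≢a

  unsettles-intro : ∀ {k y q w} → to k y ≡ y → to k q ≡ q → E y q → E y w → to k w ≢ w → Unsettles k y q
  unsettles-intro {k} {q = q} {w} ky≡y kq≡q eq ew kw≢w {u} eu u≢q ku≡u = w≢u (to-injective k (trans kw≡u (sym ku≡u)))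
    where
    w≢u : w ≢ u
    w≢u refl = kw≢w ku≡u
    q≢w : q ≢ w
    q≢w refl = kw≢w kq≡q
    kw≡u : to k w ≡ u
    kw≡u = moved-neighbour {k} ky≡y kq≡q eq ew eu q≢w (≢-sym u≢q) w≢u kw≢w

  conjugate-unsettles : ∀ (g : Aut Γ) {k y q} → Unsettles k y q → Unsettles (g · k · g ⁻¹) (to g y) (to g q)
  conjugate-unsettles g {y = y} unsettles {w} e w≢gq k′w≡w = unsettles
    (subst (λ z → E z (from g w)) (from-to g y) (pres (g ⁻¹) e))
    (λ w′≡q → w≢gq (trans (sym (to-from g w)) (cong (to g) w′≡q)))
    (to-injective g (trans k′w≡w (sym (to-from g w))))

  record NonRigidArc (s : ℕ) : Set where
    field
      {y q}     : V
      {r}       : List V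
      arc       : Arc s (y ∷ q ∷ r)
      k         : Aut Γ
      k∈G       : G k
      fixes     : Fixes k (y ∷ q ∷ r)
      unsettles : Unsettles k y q

  not-rigid⇒nonRigidArc : ∀ {t} → ¬ Rigid (suc t) → ¬ ¬ NonRigidArc (suc t)
  not-rigid⇒nonRigidArc {t} not-rigid no-witness = not-rigid rigid
    where
    rigid : Rigid (suc t)
    rigid {l = []} (_ , ())
    rigid {l = q ∷ r} {k} {w} arc k∈G fix e with adjacent-≟ (subst (λ z → E z (to k w)) (All.head fix) (pres k e)) e
    ... | yes kw≡w = kw≡w
    ... | no kw≢w = contradiction (record { arc = arc ; k = k ; k∈G = k∈G ; fixes = fix ; unsettles =
      unsettles-intro {k} (All.head fix) (All.head (All.tail fix)) (Linked.head (proj₁ (proj₁ arc))) e kw≢w })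
      no-witness

  SArcTransitive : ℕ → Set
  SArcTransitive s = ∀ {y q r y′ q′ r′} → Arc s (y ∷ q ∷ r) → Arc s (y′ ∷ q′ ∷ r′) →
    ¬ ¬ ∃ λ g → G g × map (to g) (y ∷ q ∷ r) ≡ y′ ∷ q′ ∷ r′

  spread-nonRigid : ∀ {s} → SArcTransitive s → NonRigidArc s → ∀ {d₁ d₂ ds} → Arc s (d₁ ∷ d₂ ∷ ds) →
    ¬ ¬ ∃ λ k′ → G k′ × Fixes k′ (d₁ ∷ d₂ ∷ ds) × Unsettles k′ d₁ d₂
  spread-nonRigid transitive W δ = do
    (g , g∈G , gβ≡δ) ← transitive arc δ
    pure (conjugate g g∈G gβ≡δ)
    where
    open NonRigidArc W
    conjugate : ∀ (g : Aut Γ) → G g → ∀ {d₁ d₂ ds} → map (to g) (y ∷ q ∷ r) ≡ d₁ ∷ d₂ ∷ ds →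
      ∃ λ k′ → G k′ × Fixes k′ (d₁ ∷ d₂ ∷ ds) × Unsettles k′ d₁ d₂
    conjugate g g∈G refl = g · k · g ⁻¹ , has-∘ g∈G (has-∘ k∈G (has-inv g∈G)) ,
      conjugate-fixes g {k} fixes , conjugate-unsettles g {k} unsettles

  -- Map the tails into place by s-arc transitivity; a stabiliser of the tail then swaps the head into place.
  extend-transitivity : ∀ {t} → SArcTransitive (suc t) → NonRigidArc (suc t) → SArcTransitive (suc (suc t))
  extend-transitivity T W {r = []} (_ , ()) _
  extend-transitivity T W {r′ = []} _ (_ , ())
  extend-transitivity T W {c₀} {c₁} {c₂ ∷ r₀} {d₀} {d₁} {d₂ ∷ s₀}
    γ@((γ-path , c₀≢c₂ , _) , _) δ@((δ-path , d₀≢d₂ , _) , _) = do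
      (h , h∈G , hγ′≡δ′) ← T (tail-arc γ) (tail-arc δ)
      (k , k∈G , fixes , unsettles) ← spread-nonRigid T W (tail-arc δ)
      pure (place-head h h∈G hγ′≡δ′ k k∈G fixes unsettles)
    where
    tail-arc : ∀ {s a l} → Arc (suc s) (a ∷ l) → Arc s l
    tail-arc (arc , len) = arc-tail arc , suc-injective len

    place-head : ∀ (h : Aut Γ) → G h → map (to h) (c₁ ∷ c₂ ∷ r₀) ≡ d₁ ∷ d₂ ∷ s₀ →
      ∀ (k : Aut Γ) → G k → Fixes k (d₁ ∷ d₂ ∷ s₀) → Unsettles k d₁ d₂ →
      ∃ λ g → G g × map (to g) (c₀ ∷ c₁ ∷ c₂ ∷ r₀) ≡ d₀ ∷ d₁ ∷ d₂ ∷ s₀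
    place-head h h∈G hγ′≡δ′ k k∈G fixes unsettles = place (adjacent-≟ d₁—hc₀ d₁—d₀)
      where
      open ≡-Reasoning
      d₁—d₀ : E d₁ d₀
      d₁—d₀ = E-sym (Linked.head δ-path)
      d₁—hc₀ : E d₁ (to h c₀)
      d₁—hc₀ = subst (λ z → E z (to h c₀)) (∷-injectiveˡ hγ′≡δ′) (pres h (E-sym (Linked.head γ-path)))
      hc₀≢d₂ : to h c₀ ≢ d₂
      hc₀≢d₂ hc₀≡d₂ = c₀≢c₂ (to-injective h (trans hc₀≡d₂ (sym (∷-injectiveˡ (∷-injectiveʳ hγ′≡δ′)))))
      khγ′≡δ′ : map (to (k · h)) (c₁ ∷ c₂ ∷ r₀) ≡ d₁ ∷ d₂ ∷ s₀
      khγ′≡δ′ = begin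
        map (to (k · h)) (c₁ ∷ c₂ ∷ r₀)        ≡⟨ map-∘ (c₁ ∷ c₂ ∷ r₀) ⟩
        map (to k) (map (to h) (c₁ ∷ c₂ ∷ r₀)) ≡⟨ cong (map (to k)) hγ′≡δ′ ⟩
        map (to k) (d₁ ∷ d₂ ∷ s₀)              ≡⟨ map-id-local fixes ⟩
        d₁ ∷ d₂ ∷ s₀                           ∎
      place : Dec (to h c₀ ≡ d₀) →
        ∃ λ g → G g × map (to g) (c₀ ∷ c₁ ∷ c₂ ∷ r₀) ≡ d₀ ∷ d₁ ∷ d₂ ∷ s₀
      place (yes hc₀≡d₀) = h , h∈G , cong₂ _∷_ hc₀≡d₀ hγ′≡δ′
      place (no hc₀≢d₀)  = k · h , has-∘ k∈G h∈G , cong₂ _∷_ khc₀≡d₀ khγ′≡δ′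
        where
        khc₀≡d₀ : to k (to h c₀) ≡ d₀
        khc₀≡d₀ = moved-neighbour {k} (All.head fixes) (All.head (All.tail fixes)) (Linked.head (Linked.tail δ-path))
          d₁—hc₀ d₁—d₀ (≢-sym hc₀≢d₂) (≢-sym d₀≢d₂) hc₀≢d₀ (unsettles d₁—hc₀ hc₀≢d₂)

  ArcTransitive : Set
  ArcTransitive = ∀ {a b a′ b′} → E a b → E a′ b′ → ¬ ¬ ∃ λ g → G g × to g a ≡ a′ × to g b ≡ b′

  arcTransitive⇒1-arcTransitive : ArcTransitive → SArcTransitive 1
  arcTransitive⇒1-arcTransitive AT {r = _ ∷ _} (_ , ()) _
  arcTransitive⇒1-arcTransitive AT {r′ = _ ∷ _} _ (_ , ())
  arcTransitive⇒1-arcTransitive AT {r = []} {r′ = []} ((e ∷ _ , _) , _) ((e′ ∷ _ , _) , _) = do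
    (g , g∈G , ga≡a′ , gb≡b′) ← AT e e′
    pure (g , g∈G , cong₂ _∷_ ga≡a′ (cong₂ _∷_ gb≡b′ refl))

  s-arcTransitive : V → ArcTransitive → ∀ t → SArcTransitive (suc t)
  s-arcTransitive v₀ AT zero    = arcTransitive⇒1-arcTransitive AT
  s-arcTransitive v₀ AT (suc t) γ δ = do
    W ← not-rigid⇒nonRigidArc (not-rigid v₀ (suc t))
    extend-transitivity (s-arcTransitive v₀ AT t) W γ δ

  -- Another neighbour w of y gives an s-arc with the same tail: mapping one onto the other fixes x but
  -- sends it to w.
  no-returning-arc : ∀ {s x y c rest} → SArcTransitive s → Arc s (x ∷ y ∷ c ∷ rest) → x ∈ rest → ⊥
  no-returning-arc T ((p , x≢c , q) , len) x∈rest
    with third-neighbour (E-sym (Linked.head p)) (Linked.head (Linked.tail p)) x≢c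
  ... | w , e , w≢x , w≢c = T ((p , x≢c , q) , len) (((E-sym e ∷ Linked.tail p) , w≢c , q) , len)
    λ (g , _ , gα≡α′) → w≢x (trans (sym (∷-injectiveˡ gα≡α′))
      (All.lookup (map-fixes g (∷-injectiveʳ gα≡α′)) (there (there x∈rest))))

corollary3p4 : (Γ : Graph) → Trivalent Γ → Connected Γ →
    (G : Aut Γ → Set) → IsSubgroup Γ G →
    VertexTransitive Γ G → EdgeTransitive Γ G →
    (∀ v → InfiniteStabilizer Γ G v) →
    IsTree Γ
corollary3p4 Γ tri conn G sg vt et infinite = conn , acyclic
  where
  open Tutte Γ tri conn G sg infinite
  acyclic : Acyclic Γ
  acyclic cycle with Arcs.cycle-closedArc Γ cycle
  ... | a , b , c , m , closed = no-returning-arc (s-arcTransitive a arcTransitive _) (closed , refl) (∈-++⁺ʳ m (here refl))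
    where
    arcTransitive : ArcTransitive
    arcTransitive euv exy no-map = HalfArcTransitive.no-closedArc Γ tri G sg vt et euv exy no-map (c ∷ m) closed
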